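{- Let $m \ge 2$ and $n \ge 1$ be integers. Let $K_m = (V, E)$ be the complete graph on $m$ vertices, and let $E = E_1 \cup \dots \cup E_n$ be a partition of its edge set into $n$ parts. Define the load balance $\alpha = \min_{i} \frac{|E_i| \cdot n}{|E|}$ and the replication factor $RF = \frac{\sum_{i=1}^{n} |V(E_i)|}{|V|}$, where $V(E_i)$ denotes the set of vertices incident to at least one edge of $E_i$. Then $$RF \ge \sqrt{\alpha}\cdot\sqrt{n}\cdot\sqrt{\frac{m-1}{m}}.$$
   Context: An edge partition of a graph $(V,E)$ into $n$ parts is a family of pairwise disjoint sets $E_1,\dots,E_n$ (possibly empty) whose union is $E$. -}

module Defs where

open import Data.Nat using (ℕ; zero; suc)
open import Data.Bool using (Bool; true; false; _∨_)
open import Data.Fin using (Fin; _<_; _<?_)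
open import Data.Fin.Properties using (_≟_)
open import Data.List using (List; []; _∷_; length; filterᵇ; cartesianProduct; allFin; map)
open import Data.Bool.ListAction using (any)
open import Data.Nat.ListAction using (sum)
open import Data.Product using (_×_; _,_)
open import Data.Integer using (+_)
open import Data.Rational using (ℚ; 0ℚ; _/_; _⊓_)
open import Relation.Nullary using (yes; no)
open import Relation.Nullary.Decidable using (⌊_⌋)

-- Vertices of K_m are Fin m; edges are the pairs (i , j) with i < j.
-- An edge partition into n parts is an assignment of a part index to every edge:
-- E_k = { {i,j} : i < j , part i j (i<j) = k }.  (Parts may be empty.)
EdgePartition : ℕ → ℕ → Set
EdgePartition m n = (i j : Fin m) → i < j → Fin n

inPart : ∀ {m n} → EdgePartition m n → Fin n → Fin m → Fin m → Bool
inPart c k i j with i <? j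
... | yes p = ⌊ c i j p ≟ k ⌋
... | no _  = false

edgeList : (m : ℕ) → List (Fin m × Fin m)
edgeList m = filterᵇ (λ { (i , j) → ⌊ i <? j ⌋ }) (cartesianProduct (allFin m) (allFin m))

numEdges : ℕ → ℕ
numEdges m = length (edgeList m)

partSize : ∀ {m n} → EdgePartition m n → Fin n → ℕ
partSize {m} c k = length (filterᵇ (λ { (i , j) → inPart c k i j }) (edgeList m))

partVertices : ∀ {m n} → EdgePartition m n → Fin n → ℕ
partVertices {m} c k =
  length (filterᵇ (λ v → any (λ u → inPart c k u v ∨ inPart c k v u) (allFin m)) (allFin m))

-- rational a / b  (with the convention a / 0 = 0; only used with b ≠ 0)
_//_ : ℕ → ℕ → ℚ
a // zero = 0ℚ
a // suc b = (+ a) / suc b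

-- minimum of a nonempty list (0 on the empty list; only used on nonempty lists)
minList : List ℚ → ℚ
minList [] = 0ℚ
minList (x ∷ []) = x
minList (x ∷ y ∷ ys) = x ⊓ minList (y ∷ ys)

loadBalance : ∀ {m n} → EdgePartition m n → ℚ
loadBalance {m} {n} c = minList (map (λ k → (partSize c k Data.Nat.* n) // numEdges m) (allFin n))

replicationFactor : ∀ {m n} → EdgePartition m n → ℚ
replicationFactor {m} {n} c = sum (map (partVertices c) (allFin n)) // m

module Submission where

-- Let E_k be a part touching the fewest vertices, V_k of them. The definition of α gives
-- α |E| ≤ n |E_k|; the edges of E_k join vertices of V(E_k), so 2 |E_k| ≤ V_k²; minimality
-- gives n V_k ≤ Σ_i |V(E_i)| = m RF; and 2 |E| = m (m - 1). Chaining these,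
-- α n (m - 1) / m ≤ n² V_k² / m² ≤ RF², which is the claim squared.

open import Defs

module Counting where

  open import Data.Bool using (Bool; true; false; T; _∨_)
  open import Data.Bool.ListAction using (any)
  open import Data.Bool.Properties using (T-∨)
  open import Data.Fin using (Fin; _<?_) renaming (_<_ to _<ᶠ_)
  open import Data.Fin.Properties using (_≟_; <-cmp; <-asym)
  open import Data.List using ([]; _∷_; length; filterᵇ; cartesianProduct; allFin; map; tabulate; _++_)
  open import Data.List.Properties using (map-tabulate; map-++; map-∘)
  open import Data.List.Membership.Propositional using (lose)
  open import Data.List.Membership.Propositional.Properties using (∈-allFin)
  open import Data.List.Relation.Unary.Any.Properties using (any⁺)
  import Data.Nat.ListAction as List
  open import Data.Nat.ListAction.Properties using (sum-++)
  open import Data.Nat using (ℕ; zero; suc; _+_; _*_; _∸_; _≤_; z≤n)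
  open import Data.Nat.Properties
    using (+-*-semiring; +-mono-≤; *-mono-≤; *-monoˡ-≤; ≤-refl; ≤-trans; ≤-reflexive; <⇒≤; ≰⇒>; _≤?_;
           +-identityʳ; *-identityʳ; *-suc; +-comm; +-cancelʳ-≡; *-cancelˡ-≤; module ≤-Reasoning)
  open import Data.Nat.Tactic.RingSolver using (solve)
  open import Data.Product using (_×_; _,_; ∃-syntax; proj₁; proj₂)
  open import Data.Sum using (_⊎_; inj₁; inj₂)
  open import Data.Vec.Functional using (Vector)
  open import Algebra.Properties.Semiring.Sum +-*-semiring
    using (sum; sum-syntax; sum-cong-≗; sum-replicate-zero; ∑-distrib-+; ∑-comm; *-distribˡ-sum; *-distribʳ-sum)
  open import Function using (_∘_; id; Equivalence)
  open import Relation.Binary using (tri<; tri≈; tri>)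
  open import Relation.Binary.PropositionalEquality
  open import Relation.Nullary using (Dec; ¬_; contradiction)
  open import Relation.Nullary.Decidable using (⌊_⌋; ⌊⌋-map′; yes; no)

  𝟙 : Bool → ℕ
  𝟙 true  = 1
  𝟙 false = 0

  ∑-mono-≤ : ∀ {n} {f g : Vector ℕ n} → (∀ i → f i ≤ g i) → sum f ≤ sum g
  ∑-mono-≤ {zero}  f≤g = z≤n
  ∑-mono-≤ {suc n} f≤g = +-mono-≤ (f≤g Fin.zero) (∑-mono-≤ (f≤g ∘ Fin.suc))

  ∑-const : ∀ n c → ∑[ i < n ] c ≡ n * c
  ∑-const zero    c = refl
  ∑-const (suc n) c = cong (c +_) (∑-const n c)

  *-≤-∑ : ∀ {n} {f : Vector ℕ n} {v} → (∀ i → v ≤ f i) → n * v ≤ sum f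
  *-≤-∑ {n} {v = v} v≤f = ≤-trans (≤-reflexive (sym (∑-const n v))) (∑-mono-≤ v≤f)

  ∑∑-* : ∀ {m n} (f : Vector ℕ m) (g : Vector ℕ n) →
    ∑[ i < m ] ∑[ j < n ] (f i * g j) ≡ sum f * sum g
  ∑∑-* f g = begin
    ∑[ i < _ ] ∑[ j < _ ] (f i * g j) ≡⟨ sum-cong-≗ (λ i → sym (*-distribˡ-sum (f i) g)) ⟩
    ∑[ i < _ ] (f i * sum g)          ≡⟨ sym (*-distribʳ-sum (sum g) f) ⟩
    sum f * sum g                     ∎
    where open ≡-Reasoning

  2*∑∑≡∑∑-sym : ∀ {n} (a : Fin n → Fin n → ℕ) →
    2 * ∑[ i < n ] ∑[ j < n ] a i j ≡ ∑[ i < n ] ∑[ j < n ] (a i j + a j i)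
  2*∑∑≡∑∑-sym {n} a = begin
    2 * A                                             ≡⟨ cong (A +_) (+-identityʳ A) ⟩
    A + A                                             ≡⟨ cong (A +_) (∑-comm a) ⟩
    A + ∑[ i < n ] ∑[ j < n ] a j i                    ≡⟨ sym (∑-distrib-+ {n} _ _) ⟩
    ∑[ i < n ] (∑[ j < n ] a i j + ∑[ j < n ] a j i)   ≡⟨ sum-cong-≗ {n} (λ i → sym (∑-distrib-+ {n} _ _)) ⟩
    ∑[ i < n ] ∑[ j < n ] (a i j + a j i)              ∎
    where
    open ≡-Reasoning
    A = ∑[ i < n ] ∑[ j < n ] a i j

  2*∑∑≤∑*∑ : ∀ {n} (a : Fin n → Fin n → ℕ) (w : Vector ℕ n) →
    (∀ i j → a i j + a j i ≤ w i * w j) → 2 * ∑[ i < n ] ∑[ j < n ] a i j ≤ sum w * sum w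
  2*∑∑≤∑*∑ a w a≤w = begin
    2 * ∑[ i < _ ] ∑[ j < _ ] a i j         ≡⟨ 2*∑∑≡∑∑-sym a ⟩
    ∑[ i < _ ] ∑[ j < _ ] (a i j + a j i)  ≤⟨ ∑-mono-≤ (λ i → ∑-mono-≤ (a≤w i)) ⟩
    ∑[ i < _ ] ∑[ j < _ ] (w i * w j)      ≡⟨ ∑∑-* w w ⟩
    sum w * sum w                          ∎
    where open ≤-Reasoning

  ∑-𝟙≟≡1 : ∀ {n} (i : Fin n) → ∑[ j < n ] 𝟙 ⌊ i ≟ j ⌋ ≡ 1
  ∑-𝟙≟≡1 {suc n} Fin.zero    = cong suc (sum-replicate-zero n)
  ∑-𝟙≟≡1 {suc n} (Fin.suc i) = trans (sum-cong-≗ (λ j → cong 𝟙 (⌊⌋-map′ _ _ (i ≟ j)))) (∑-𝟙≟≡1 i)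

  𝟙⌊yes⌋ : ∀ {P : Set} (d : Dec P) → P → 𝟙 ⌊ d ⌋ ≡ 1
  𝟙⌊yes⌋ (yes _) _ = refl
  𝟙⌊yes⌋ (no ¬p) p = contradiction p ¬p

  𝟙⌊no⌋ : ∀ {P : Set} (d : Dec P) → ¬ P → 𝟙 ⌊ d ⌋ ≡ 0
  𝟙⌊no⌋ (yes p) ¬p = contradiction p ¬p
  𝟙⌊no⌋ (no _)  _  = refl

  𝟙<+𝟙>+𝟙≟≡1 : ∀ {n} (i j : Fin n) → 𝟙 ⌊ i <? j ⌋ + 𝟙 ⌊ j <? i ⌋ + 𝟙 ⌊ i ≟ j ⌋ ≡ 1
  𝟙<+𝟙>+𝟙≟≡1 i j with <-cmp i j
  ... | tri< i<j i≢j j≮i rewrite 𝟙⌊yes⌋ (i <? j) i<j | 𝟙⌊no⌋ (j <? i) j≮i | 𝟙⌊no⌋ (i ≟ j) i≢j = refl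
  ... | tri≈ i≮j i≡j j≮i rewrite 𝟙⌊no⌋ (i <? j) i≮j | 𝟙⌊no⌋ (j <? i) j≮i | 𝟙⌊yes⌋ (i ≟ j) i≡j = refl
  ... | tri> i≮j i≢j j<i rewrite 𝟙⌊no⌋ (i <? j) i≮j | 𝟙⌊yes⌋ (j <? i) j<i | 𝟙⌊no⌋ (i ≟ j) i≢j = refl

  𝟙∧ : ∀ {x y} → T x × T y → 𝟙 x * 𝟙 y ≡ 1
  𝟙∧ {true} {true} _ = refl

  𝟙+𝟙≤𝟙*𝟙 : ∀ {a b x y} → (T a ⊎ T b → T x × T y) → ¬ (T a × T b) → 𝟙 a + 𝟙 b ≤ 𝟙 x * 𝟙 y
  𝟙+𝟙≤𝟙*𝟙 {false} {false} _     _   = z≤n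
  𝟙+𝟙≤𝟙*𝟙 {true}  {false} ab⇒xy _   = ≤-reflexive (sym (𝟙∧ (ab⇒xy (inj₁ _))))
  𝟙+𝟙≤𝟙*𝟙 {false} {true}  ab⇒xy _   = ≤-reflexive (sym (𝟙∧ (ab⇒xy (inj₂ _))))
  𝟙+𝟙≤𝟙*𝟙 {true}  {true}  _     ¬ab = contradiction _ ¬ab

  length-filterᵇ : ∀ {A : Set} (p : A → Bool) xs → length (filterᵇ p xs) ≡ List.sum (map (𝟙 ∘ p) xs)
  length-filterᵇ p []       = refl
  length-filterᵇ p (x ∷ xs) with p x
  ... | true  = cong suc (length-filterᵇ p xs)
  ... | false = length-filterᵇ p xs

  sum-map-filterᵇ : ∀ {A : Set} (p : A → Bool) (f : A → ℕ) xs →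
    List.sum (map f (filterᵇ p xs)) ≡ List.sum (map (λ x → 𝟙 (p x) * f x) xs)
  sum-map-filterᵇ p f []       = refl
  sum-map-filterᵇ p f (x ∷ xs) with p x
  ... | true  = cong₂ _+_ (sym (+-identityʳ (f x))) (sum-map-filterᵇ p f xs)
  ... | false = sum-map-filterᵇ p f xs

  sum-tabulate : ∀ {n} (f : Vector ℕ n) → List.sum (tabulate f) ≡ sum f
  sum-tabulate {zero}  f = refl
  sum-tabulate {suc n} f = cong (f Fin.zero +_) (sum-tabulate (f ∘ Fin.suc))

  sum-map-allFin : ∀ n (f : Vector ℕ n) → List.sum (map f (allFin n)) ≡ sum f
  sum-map-allFin n f = trans (cong List.sum (map-tabulate id f)) (sum-tabulate f)

  sum-map-cartesianProduct : ∀ {A B : Set} (f : A × B → ℕ) xs ys →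
    List.sum (map f (cartesianProduct xs ys)) ≡ List.sum (map (λ x → List.sum (map (λ y → f (x , y)) ys)) xs)
  sum-map-cartesianProduct f []       ys = refl
  sum-map-cartesianProduct f (x ∷ xs) ys = begin
    List.sum (map f (map (x ,_) ys ++ cartesianProduct xs ys))
      ≡⟨ cong List.sum (map-++ f (map (x ,_) ys) _) ⟩
    List.sum (map f (map (x ,_) ys) ++ map f (cartesianProduct xs ys))
      ≡⟨ sum-++ (map f (map (x ,_) ys)) _ ⟩
    List.sum (map f (map (x ,_) ys)) + List.sum (map f (cartesianProduct xs ys))
      ≡⟨ cong₂ _+_ (cong List.sum (sym (map-∘ ys))) (sum-map-cartesianProduct f xs ys) ⟩
    List.sum (map (λ y → f (x , y)) ys) + List.sum (map (λ x → List.sum (map (λ y → f (x , y)) ys)) xs) ∎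
    where open ≡-Reasoning

  sum-map-allFin² : ∀ n (f : Fin n × Fin n → ℕ) →
    List.sum (map f (cartesianProduct (allFin n) (allFin n))) ≡ ∑[ i < n ] ∑[ j < n ] f (i , j)
  sum-map-allFin² n f = begin
    List.sum (map f (cartesianProduct (allFin n) (allFin n)))
      ≡⟨ sum-map-cartesianProduct f (allFin n) (allFin n) ⟩
    List.sum (map (λ i → List.sum (map (λ j → f (i , j)) (allFin n))) (allFin n))
      ≡⟨ sum-map-allFin n _ ⟩
    ∑[ i < n ] List.sum (map (λ j → f (i , j)) (allFin n))
      ≡⟨ sum-cong-≗ {n} (λ i → sum-map-allFin n _) ⟩
    ∑[ i < n ] ∑[ j < n ] f (i , j) ∎
    where open ≡-Reasoning

  Fin-argmin : ∀ {n} (f : Fin (suc n) → ℕ) → ∃[ k ] (∀ j → f k ≤ f j)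
  Fin-argmin {zero}  f = Fin.zero , λ { Fin.zero → ≤-refl }
  Fin-argmin {suc n} f with Fin-argmin (f ∘ Fin.suc)
  ... | k , fk≤ with f Fin.zero ≤? f (Fin.suc k)
  ...   | yes f0≤fk = Fin.zero , λ { Fin.zero → ≤-refl ; (Fin.suc j) → ≤-trans f0≤fk (fk≤ j) }
  ...   | no  f0≰fk = Fin.suc k , λ { Fin.zero → <⇒≤ (≰⇒> f0≰fk) ; (Fin.suc j) → fk≤ j }

  n*min≤sum : ∀ {n} (f : Fin n → ℕ) {k} → (∀ j → f k ≤ f j) → n * f k ≤ List.sum (map f (allFin n))
  n*min≤sum {n} f fk≤ = subst (n * _ ≤_) (sym (sum-map-allFin n f)) (*-≤-∑ fk≤)

  numEdges≡∑∑ : ∀ m → numEdges m ≡ ∑[ i < m ] ∑[ j < m ] 𝟙 ⌊ i <? j ⌋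
  numEdges≡∑∑ m = trans (length-filterᵇ _ (cartesianProduct (allFin m) (allFin m))) (sum-map-allFin² m _)

  ∑∑-diagonal : ∀ m → ∑[ i < m ] ∑[ j < m ] 𝟙 ⌊ i ≟ j ⌋ ≡ m
  ∑∑-diagonal m = trans (sum-cong-≗ {m} ∑-𝟙≟≡1) (trans (∑-const m 1) (*-identityʳ m))

  2*numEdges+m≡m*m : ∀ m → 2 * numEdges m + m ≡ m * m
  2*numEdges+m≡m*m m = begin
    2 * numEdges m + m
      ≡⟨ cong₂ _+_ (cong (2 *_) (numEdges≡∑∑ m)) (sym (∑∑-diagonal m)) ⟩
    2 * ∑[ i < m ] ∑[ j < m ] 𝟙 ⌊ i <? j ⌋ + ∑[ i < m ] ∑[ j < m ] 𝟙 ⌊ i ≟ j ⌋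
      ≡⟨ cong (_+ ∑[ i < m ] ∑[ j < m ] 𝟙 ⌊ i ≟ j ⌋) (2*∑∑≡∑∑-sym {m} (λ i j → 𝟙 ⌊ i <? j ⌋)) ⟩
    ∑[ i < m ] ∑[ j < m ] (𝟙 ⌊ i <? j ⌋ + 𝟙 ⌊ j <? i ⌋) + ∑[ i < m ] ∑[ j < m ] 𝟙 ⌊ i ≟ j ⌋
      ≡⟨ sym (∑-distrib-+ {m} _ _) ⟩
    ∑[ i < m ] (∑[ j < m ] (𝟙 ⌊ i <? j ⌋ + 𝟙 ⌊ j <? i ⌋) + ∑[ j < m ] 𝟙 ⌊ i ≟ j ⌋)
      ≡⟨ sum-cong-≗ {m} (λ i → trans (sym (∑-distrib-+ {m} _ _)) (sum-cong-≗ {m} (𝟙<+𝟙>+𝟙≟≡1 i))) ⟩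
    ∑[ i < m ] ∑[ j < m ] 1
      ≡⟨ trans (sum-cong-≗ {m} (λ _ → trans (∑-const m 1) (*-identityʳ m))) (∑-const m m) ⟩
    m * m ∎
    where open ≡-Reasoning

  m*[m∸1]+m≡m*m : ∀ m → m * (m ∸ 1) + m ≡ m * m
  m*[m∸1]+m≡m*m zero    = refl
  m*[m∸1]+m≡m*m (suc m) = trans (+-comm (suc m * m) (suc m)) (sym (*-suc (suc m) m))

  2*numEdges≡m*[m∸1] : ∀ m → 2 * numEdges m ≡ m * (m ∸ 1)
  2*numEdges≡m*[m∸1] m = +-cancelʳ-≡ m _ _ (trans (2*numEdges+m≡m*m m) (sym (m*[m∸1]+m≡m*m m)))

  module _ {m n} (c : EdgePartition m n) (k : Fin n) where

    incident : Fin m → Bool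
    incident v = any (λ u → inPart c k u v ∨ inPart c k v u) (allFin m)

    inPart⇒< : ∀ i j → T (inPart c k i j) → i <ᶠ j
    inPart⇒< i j with i <? j
    ... | yes i<j = λ _ → i<j

    inPart⇒incident : ∀ i j → T (inPart c k i j) ⊎ T (inPart c k j i) → T (incident i) × T (incident j)
    inPart⇒incident i j e =
      any⁺ _ (lose (∈-allFin j) (Equivalence.from T-∨ (swap e))) , any⁺ _ (lose (∈-allFin i) (Equivalence.from T-∨ e))
      where
      swap : ∀ {A B : Set} → A ⊎ B → B ⊎ A
      swap (inj₁ a) = inj₂ a
      swap (inj₂ b) = inj₁ b

    partSize≡∑∑ : partSize c k ≡ ∑[ i < m ] ∑[ j < m ] 𝟙 (inPart c k i j)
    partSize≡∑∑ = begin
      partSize c k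
        ≡⟨ length-filterᵇ q (edgeList m) ⟩
      List.sum (map (𝟙 ∘ q) (edgeList m))
        ≡⟨ sum-map-filterᵇ (λ x → ⌊ proj₁ x <? proj₂ x ⌋) (𝟙 ∘ q) (cartesianProduct (allFin m) (allFin m)) ⟩
      List.sum (map (λ x → 𝟙 ⌊ proj₁ x <? proj₂ x ⌋ * 𝟙 (q x)) (cartesianProduct (allFin m) (allFin m)))
        ≡⟨ sum-map-allFin² m _ ⟩
      ∑[ i < m ] ∑[ j < m ] (𝟙 ⌊ i <? j ⌋ * 𝟙 (inPart c k i j))
        ≡⟨ sum-cong-≗ {m} (λ i → sum-cong-≗ {m} (𝟙<*𝟙inPart i)) ⟩
      ∑[ i < m ] ∑[ j < m ] 𝟙 (inPart c k i j) ∎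
      where
      open ≡-Reasoning
      q : Fin m × Fin m → Bool
      q (i , j) = inPart c k i j
      𝟙<*𝟙inPart : ∀ i j → 𝟙 ⌊ i <? j ⌋ * 𝟙 (inPart c k i j) ≡ 𝟙 (inPart c k i j)
      𝟙<*𝟙inPart i j with i <? j
      ... | yes _ = +-identityʳ _
      ... | no  _ = refl

    partVertices≡∑ : partVertices c k ≡ ∑[ v < m ] 𝟙 (incident v)
    partVertices≡∑ = trans (length-filterᵇ incident (allFin m)) (sum-map-allFin m _)

    2*partSize≤partVertices² : 2 * partSize c k ≤ partVertices c k * partVertices c k
    2*partSize≤partVertices² = subst₂ (λ e v → 2 * e ≤ v * v) (sym partSize≡∑∑) (sym partVertices≡∑)
      (2*∑∑≤∑*∑ (λ i j → 𝟙 (inPart c k i j)) (𝟙 ∘ incident) λ i j →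
        𝟙+𝟙≤𝟙*𝟙 (inPart⇒incident i j) λ (ij , ji) → <-asym (inPart⇒< i j ij) (inPart⇒< j i ji))

  -- The shape of both sides (including E * 1) is what //-*-// produces in theorem3.
  cross-multiplied-bound : ∀ {e v n S E m p} → 2 * e ≤ v * v → n * v ≤ S → 2 * E ≡ m * p →
    e * n * n * p * (m * m) ≤ S * S * (E * 1 * m)
  cross-multiplied-bound {e} {v} {n} {S} {E} {m} {p} 2e≤v² nv≤S 2E≡mp = *-cancelˡ-≤ 2 (begin
    2 * (e * n * n * p * (m * m)) ≡⟨ solve (e ∷ n ∷ p ∷ m ∷ []) ⟩
    (2 * e) * (n * n) * (m * p * m) ≤⟨ *-monoˡ-≤ (m * p * m) (*-monoˡ-≤ (n * n) 2e≤v²) ⟩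
    (v * v) * (n * n) * (m * p * m) ≡⟨ solve (v ∷ n ∷ p ∷ m ∷ []) ⟩
    (n * v) * (n * v) * (m * p * m) ≤⟨ *-monoˡ-≤ (m * p * m) (*-mono-≤ nv≤S nv≤S) ⟩
    S * S * (m * p * m)             ≡⟨ cong (λ x → S * S * (x * m)) (sym 2E≡mp) ⟩
    S * S * (2 * E * m)             ≡⟨ solve (S ∷ E ∷ m ∷ []) ⟩
    2 * (S * S * (E * 1 * m))       ∎)
    where open ≤-Reasoning

module Fractions where

  open import Data.Nat as ℕ using (zero; suc)
  import Data.Nat.Properties as ℕ
  import Data.Integer as ℤ
  import Data.Integer.Properties as ℤ
  open import Data.Rational using (_*_; _≤_; toℚᵘ; NonNegative)
  open import Data.Rational.Properties
    using (normalize-nonNeg; nonNegative⁻¹; *-zeroˡ; *-zeroʳ; ≤-refl; ≤-trans; p⊓q≤p; p⊓q≤q;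
           toℚᵘ-cancel-≤; toℚᵘ-homo-*; toℚᵘ-injective; toℚᵘ-fromℚᵘ)
  import Data.Rational.Unnormalised as ℚᵘ
  import Data.Rational.Unnormalised.Properties as ℚᵘ
  open import Data.List using (_∷_; [])
  open import Data.List.Membership.Propositional using (_∈_)
  open import Data.List.Relation.Unary.Any using (here; there)
  open import Relation.Binary.PropositionalEquality

  //-nonNeg : ∀ a b → NonNegative (a // b)
  //-nonNeg a zero    = _
  //-nonNeg a (suc b) = normalize-nonNeg a (suc b)

  -- ℚᵘ.mkℚᵘ i d denotes i / suc d.
  toℚᵘ-// : ∀ a b → toℚᵘ (a // suc b) ℚᵘ.≃ ℚᵘ.mkℚᵘ (ℤ.+ a) b
  toℚᵘ-// a b = toℚᵘ-fromℚᵘ (ℚᵘ.mkℚᵘ (ℤ.+ a) b)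

  //-*-// : ∀ a b c d → (a // b) * (c // d) ≡ (a ℕ.* c) // (b ℕ.* d)
  //-*-// a zero    c d       = *-zeroˡ (c // d)
  //-*-// a (suc b) c zero    = trans (*-zeroʳ (a // suc b)) (cong ((a ℕ.* c) //_) (sym (ℕ.*-zeroʳ (suc b))))
  //-*-// a (suc b) c (suc d) = toℚᵘ-injective (begin
    toℚᵘ ((a // suc b) * (c // suc d))                ≈⟨ toℚᵘ-homo-* (a // suc b) (c // suc d) ⟩
    toℚᵘ (a // suc b) ℚᵘ.* toℚᵘ (c // suc d)          ≈⟨ ℚᵘ.*-cong (toℚᵘ-// a b) (toℚᵘ-// c d) ⟩
    ℚᵘ.mkℚᵘ (ℤ.+ a) b ℚᵘ.* ℚᵘ.mkℚᵘ (ℤ.+ c) d         ≈⟨ ℚᵘ.*≡* (cong (ℤ._* ℤ.+ suc (d ℕ.+ b ℕ.* suc d)) (sym (ℤ.pos-* a c))) ⟩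
    ℚᵘ.mkℚᵘ (ℤ.+ (a ℕ.* c)) (d ℕ.+ b ℕ.* suc d)       ≈⟨ ℚᵘ.≃-sym (toℚᵘ-// (a ℕ.* c) (d ℕ.+ b ℕ.* suc d)) ⟩
    toℚᵘ ((a ℕ.* c) // (suc b ℕ.* suc d))             ∎)
    where open ℚᵘ.≃-Reasoning

  //-mono-≤ : ∀ a b c d .{{_ : ℕ.NonZero d}} → a ℕ.* d ℕ.≤ c ℕ.* b → a // b ≤ c // d
  //-mono-≤ a zero    c d@(suc _) _    = nonNegative⁻¹ (c // d) {{//-nonNeg c d}}
  //-mono-≤ a (suc b) c (suc d) ad≤cb = toℚᵘ-cancel-≤ (begin
    toℚᵘ (a // suc b)          ≃⟨ toℚᵘ-// a b ⟩
    ℚᵘ.mkℚᵘ (ℤ.+ a) b          ≤⟨ ℚᵘ.*≤* (subst₂ ℤ._≤_ (ℤ.pos-* a (suc d)) (ℤ.pos-* c (suc b)) (ℤ.+≤+ ad≤cb)) ⟩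
    ℚᵘ.mkℚᵘ (ℤ.+ c) d          ≃⟨ ℚᵘ.≃-sym (toℚᵘ-// c d) ⟩
    toℚᵘ (c // suc d)          ∎)
    where open ℚᵘ.≤-Reasoning

  minList-≤ : ∀ {xs x} → x ∈ xs → minList xs ≤ x
  minList-≤ {x ∷ []}     (here refl) = ≤-refl
  minList-≤ {x ∷ y ∷ ys} (here refl) = p⊓q≤p x (minList (y ∷ ys))
  minList-≤ {x ∷ y ∷ ys} (there x∈) = ≤-trans (p⊓q≤q x (minList (y ∷ ys))) (minList-≤ x∈)

open Counting
open Fractions
open import Data.Nat as ℕ using (ℕ; zero; suc; _∸_) renaming (_≤_ to _≤ℕ_)
open import Data.Rational using (_*_; _≤_)
open import Data.Rational.Properties using (*-monoʳ-≤-nonNeg; module ≤-Reasoning)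
open import Data.List using (map; allFin)
open import Data.List.Membership.Propositional.Properties using (∈-allFin; ∈-map⁺)
import Data.Nat.ListAction as List
open import Relation.Binary.PropositionalEquality using (cong; sym)
open import Data.Product using (proj₁; proj₂)

loadBalance≤ : ∀ {m n} (c : EdgePartition m n) k → loadBalance c ≤ (partSize c k ℕ.* n) // numEdges m
loadBalance≤ c k = minList-≤ (∈-map⁺ _ (∈-allFin k))

theorem3 : (m n : ℕ) → 2 ≤ℕ m → 1 ≤ℕ n → (c : EdgePartition m n) →
    loadBalance c * (n // 1) * ((m ∸ 1) // m)
      ≤ replicationFactor c * replicationFactor c
theorem3 zero      _         ()  _  _
theorem3 (suc _)   zero      _   () _
theorem3 m@(suc _) n@(suc _) _   _  c = begin
  loadBalance c * (n // 1) * ((m ∸ 1) // m)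
    ≤⟨ *-monoʳ-≤-nonNeg ((m ∸ 1) // m) {{//-nonNeg (m ∸ 1) m}}
         (*-monoʳ-≤-nonNeg (n // 1) {{//-nonNeg n 1}} (loadBalance≤ c k)) ⟩
  (e ℕ.* n) // E * (n // 1) * ((m ∸ 1) // m)
    ≡⟨ cong (_* ((m ∸ 1) // m)) (//-*-// (e ℕ.* n) E n 1) ⟩
  (e ℕ.* n ℕ.* n) // (E ℕ.* 1) * ((m ∸ 1) // m)
    ≡⟨ //-*-// (e ℕ.* n ℕ.* n) (E ℕ.* 1) (m ∸ 1) m ⟩
  (e ℕ.* n ℕ.* n ℕ.* (m ∸ 1)) // (E ℕ.* 1 ℕ.* m)
    ≤⟨ //-mono-≤ (e ℕ.* n ℕ.* n ℕ.* (m ∸ 1)) (E ℕ.* 1 ℕ.* m) (S ℕ.* S) (m ℕ.* m)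
         (cross-multiplied-bound {e} {v} {n} {S} {E} {m} {m ∸ 1}
           (2*partSize≤partVertices² c k) (n*min≤sum (partVertices c) k-min) (2*numEdges≡m*[m∸1] m)) ⟩
  (S ℕ.* S) // (m ℕ.* m)
    ≡⟨ sym (//-*-// S m S m) ⟩
  replicationFactor c * replicationFactor c ∎
  where
  open ≤-Reasoning
  k = proj₁ (Fin-argmin (partVertices c))
  k-min = proj₂ (Fin-argmin (partVertices c))
  e = partSize c k
  v = partVertices c k
  E = numEdges m
  S = List.sum (map (partVertices c) (allFin n))
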